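{- Let $T \subseteq \omega^{<\omega}$ be a tree and let $A,B \subseteq \omega^{<\omega}$. Then $\mathrm{cl}_T(A)\cup\mathrm{cl}_T(B)=\mathrm{cl}_T(A\cup B)$.
   Context: ${\uparrow}B = \{\tau : \exists \sigma \in B\ \sigma \preceq \tau\}$. Define $R^T_{B,0}={\uparrow}B$ and, for $0<\alpha<\omega_1$, $R^T_{B,\alpha}=\{\tau\in T : \text{for infinitely many } n\ \exists\beta<\alpha\ (\tau^\frown n\in R^T_{B,\beta})\}$; the $\omega$-closure of $B$ in $T$ is $\mathrm{cl}_T(B)=\bigcup_{\alpha<\omega_1}R^T_{B,\alpha}$. -}

module Defs where

open import Data.Nat using (ℕ; _≥_)
open import Data.List using (List; _++_; [_])
open import Data.Product using (Σ; ∃; _×_; _,_)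
open import Data.Sum using (_⊎_)
open import Relation.Binary.PropositionalEquality using (_≡_)

Seq : Set
Seq = List ℕ

Subset : Set₁
Subset = Seq → Set

_⪯_ : Seq → Seq → Set
σ ⪯ τ = ∃ λ ρ → σ ++ ρ ≡ τ

_⁀_ : Seq → ℕ → Seq
τ ⁀ n = τ ++ [ n ]

IsTree : Subset → Set
IsTree T = ∀ σ τ → σ ⪯ τ → T τ → T σ

↑ : Subset → Subset
↑ B τ = ∃ λ σ → B σ × σ ⪯ τ

_∪_ : Subset → Subset → Subset
(A ∪ B) τ = A τ ⊎ B τ

_≐_ : Subset → Subset → Set
X ≐ Y = ∀ τ → (X τ → Y τ) × (Y τ → X τ)

InfinitelyMany : (ℕ → Set) → Set
InfinitelyMany P = ∀ m → ∃ λ n → n ≥ m × P n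

-- Brouwer ordinals (representing the countable ordinals, i.e. those < ω₁)
data Ord : Set where
  zero : Ord
  succ : Ord → Ord
  lim  : (ℕ → Ord) → Ord

data _≺_ : Ord → Ord → Set where
  ≺-here  : ∀ {a} → a ≺ succ a
  ≺-there : ∀ {a b} → a ≺ b → a ≺ succ b
  ≺-lim   : ∀ {a f} n → a ≺ f n → a ≺ lim f

Positive : Ord → Set
Positive α = ∃ λ β → β ≺ α

data R (T B : Subset) : Ord → Seq → Set where
  base : ∀ {τ} → ↑ B τ → R T B zero τ
  step : ∀ {α τ} → Positive α → T τ →
         InfinitelyMany (λ n → ∃ λ β → β ≺ α × R T B β (τ ⁀ n)) →
         R T B α τ

cl : Subset → Subset → Subset
cl T B τ = ∃ λ α → R T B α τ

{-# OPTIONS --safe #-}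
-- Closure commutes with unions because each stage does.  Going up is monotonicity.
-- Going down is by induction on the stage: ↑(A ∪ B) = ↑A ∪ ↑B at stage zero, and at a
-- positive stage infinitely many successors τ ⁀ n lie in an earlier stage of A or of B,
-- so (classically) infinitely many of them lie in earlier stages of one and the same set.
module Submission where

open import Defs
open import Level using (0ℓ)
open import Axiom.ExcludedMiddle using (ExcludedMiddle)
open import Data.Nat using (ℕ; _≥_; _⊔_)
open import Data.Nat.Properties using (m≤m⊔n; m≤n⊔m; ≤-trans)
open import Data.Product using (∃; _×_; _,_)
open import Data.Sum using (_⊎_; inj₁; inj₂; [_,_]; map)
open import Data.Empty using (⊥-elim)
open import Relation.Nullary using (¬_; yes; no)

InfinitelyMany-⊎ : ExcludedMiddle 0ℓ → {P Q : ℕ → Set} →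
  InfinitelyMany (λ n → P n ⊎ Q n) → InfinitelyMany P ⊎ InfinitelyMany Q
InfinitelyMany-⊎ em {P} {Q} inf with em {∃ λ m₀ → ¬ (∃ λ n → n ≥ m₀ × P n)}
... | yes (m₀ , noPbeyond) = inj₂ onlyQ
  where
  onlyQ : InfinitelyMany Q
  onlyQ m with inf (m ⊔ m₀)
  ... | n , n≥ , inj₁ p = ⊥-elim (noPbeyond (n , ≤-trans (m≤n⊔m m m₀) n≥ , p))
  ... | n , n≥ , inj₂ q = n , ≤-trans (m≤m⊔n m m₀) n≥ , q
... | no noBound = inj₁ infP
  where
  infP : InfinitelyMany P
  infP m with em {∃ λ n → n ≥ m × P n}
  ... | yes p = p
  ... | no ¬p = ⊥-elim (noBound (m , ¬p))

module _ {T : Subset} where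

  EarlierSuccessor : Subset → Ord → Seq → ℕ → Set
  EarlierSuccessor B α τ n = ∃ λ β → β ≺ α × R T B β (τ ⁀ n)

  R-mono : ∀ {A B} → (∀ {σ} → A σ → B σ) → ∀ {α τ} → R T A α τ → R T B α τ
  R-mono A⊆B (base (σ , a , σ⪯τ)) = base (σ , A⊆B a , σ⪯τ)
  R-mono A⊆B (step pos Tτ inf) = step pos Tτ λ m → let n , n≥m , β , β≺α , r = inf m
                                                   in n , n≥m , β , β≺α , R-mono A⊆B r

  R-∪⁻ : ExcludedMiddle 0ℓ → ∀ {A B α τ} → R T (A ∪ B) α τ → R T A α τ ⊎ R T B α τ
  R-∪⁻ em (base (σ , inj₁ a , σ⪯τ)) = inj₁ (base (σ , a , σ⪯τ))
  R-∪⁻ em (base (σ , inj₂ b , σ⪯τ)) = inj₂ (base (σ , b , σ⪯τ))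
  R-∪⁻ em {A} {B} {α} {τ} (step pos Tτ inf) =
    map (step pos Tτ) (step pos Tτ) (InfinitelyMany-⊎ em infA⊎B)
    where
    infA⊎B : InfinitelyMany (λ n → EarlierSuccessor A α τ n ⊎ EarlierSuccessor B α τ n)
    infA⊎B m with inf m
    ... | n , n≥m , β , β≺α , r = n , n≥m , map (λ a → β , β≺α , a) (λ b → β , β≺α , b) (R-∪⁻ em r)

lemma3p8 : ExcludedMiddle 0ℓ → (T A B : Subset) → IsTree T →
    (cl T A ∪ cl T B) ≐ cl T (A ∪ B)
lemma3p8 em T A B _ τ = [ cl-mono inj₁ , cl-mono inj₂ ] , cl-∪⁻
  where
  cl-mono : ∀ {C} → (∀ {σ} → C σ → (A ∪ B) σ) → cl T C τ → cl T (A ∪ B) τ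
  cl-mono C⊆A∪B (α , r) = α , R-mono C⊆A∪B r

  cl-∪⁻ : cl T (A ∪ B) τ → (cl T A ∪ cl T B) τ
  cl-∪⁻ (α , r) = map (α ,_) (α ,_) (R-∪⁻ em r)
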